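{- Let $P_n$ be a path with endpoints $x$ and $y$. Let $L$ be a list assignment with all lists contained in $\{0,\dots,6\}$ such that every vertex of $P_n$ other than $x,y$ has a list containing $4$ cyclically consecutive colours (mod $7$), $L(x)$ and $L(y)$ are each sets of cyclically consecutive colours (intervals mod $7$), $|L(x)|\ge2$ and $|L(y)|\ge3$. Then $P_n$ has an $L$-$(7,2)$-colouring.
   Context: An $L$-$(7,2)$-colouring is a map $f:V(P_n)\to\{0,\dots,6\}$ with $f(v)\in L(v)$ for all $v$ and $2\le|f(u)-f(v)|\le5$ for every edge $uv$. -}

module Defs where

open import Data.Nat using (ℕ; zero; suc; _+_; _∸_; _≤_; _%_)
open import Data.Nat.Properties using ()
open import Data.Fin using (Fin; toℕ; fromℕ<; inject₁; suc; zero)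
open import Data.Fin.Subset using (Subset; _∈_; _⊆_)
open import Data.Product using (Σ; ∃; _×_; _,_)
open import Relation.Binary.PropositionalEquality using (_≡_)

Colour : Set
Colour = Fin 7

absDiff : ℕ → ℕ → ℕ
absDiff a b = (a ∸ b) + (b ∸ a)

Compatible : Colour → Colour → Set
Compatible c d = (2 ≤ absDiff (toℕ c) (toℕ d)) × (absDiff (toℕ c) (toℕ d) ≤ 5)

InCyclicInterval : ℕ → ℕ → Colour → Set
InCyclicInterval a k c = Σ ℕ λ i → (suc i ≤ k) × (toℕ c ≡ (a + i) % 7)

IsCyclicInterval : Subset 7 → Set
IsCyclicInterval S = Σ ℕ λ a → Σ ℕ λ k →
  (1 ≤ k) × (k ≤ 7) × (∀ (c : Colour) → (c ∈ S → InCyclicInterval a k c) × (InCyclicInterval a k c → c ∈ S))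

Contains4Consecutive : Subset 7 → Set
Contains4Consecutive S = Σ ℕ λ a → ∀ (c : Colour) → InCyclicInterval a 4 c → c ∈ S

-- The path P_m on vertices 0,…,m-1 (as Fin m), with edges {i, i+1}.
-- An L-(7,2)-colouring of P_m.
IsL72Colouring : (m : ℕ) → (Fin m → Subset 7) → (Fin m → Colour) → Set
IsL72Colouring m L f =
  (∀ v → f v ∈ L v) ×
  (∀ (i : ℕ) (p : suc (suc i) ≤ m) →
     Compatible (f (fromℕ< {i} (Data.Nat.Properties.<-trans (Data.Nat.Properties.n<1+n i) p)))
                (f (fromℕ< {suc i} p)))

-- Carry along the path two distinct candidate colours c₁ ≠ c₂ for the current
-- vertex. A colour d fails to be (7,2)-compatible with c exactly when d lies within
-- cyclic distance 1 of c, so at most two colours are incompatible with both c₁ and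
-- c₂. Hence four consecutive colours always offer two distinct colours compatible
-- with c₁ or c₂, which are the candidates for the next vertex, and at the last
-- vertex one of any three colours is compatible with one of the two candidates.
-- Starting from two colours of L(x), this colours the whole path.
module Submission where

open import Defs
open import Data.Nat using (ℕ; suc; _≤_; _<_)
open import Data.Fin using (Fin; toℕ; zero; fromℕ)
open import Data.Fin.Subset using (Subset; ∣_∣)
open import Data.Product using (Σ; _×_)
open import Relation.Nullary using (¬_)
open import Relation.Binary.PropositionalEquality using (_≡_)

open import Data.Nat using (zero; _+_; _%_; _≤?_; NonZero; s≤s; z≤n)
open import Data.Nat.Properties
  using (<⇒≱; ≤-trans; ≤-reflexive; +-monoʳ-≤; +-suc) renaming (<-≤-trans to _⟨<-≤⟩_)
open import Data.Nat.DivMod using (m%n<n; %-distribˡ-+; m%n%n≡m%n)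
open import Data.Fin using (fromℕ<; suc; _≟_)
open import Data.Fin.Properties using (all?; any?; toℕ-fromℕ<; toℕ<n; suc-injective)
open import Data.Fin.Subset using (_∈_; _∉_; _∪_; ⁅_⁆; ⊥; Nonempty; inside; outside)
open import Data.Fin.Subset.Properties
  using (_∈?_; p⊆q⇒∣p∣≤∣q∣; ∣p∣≤∣x∷p∣; ∣⊥∣≡0; ∣⁅x⁆∣≡1; x∉⁅y⁆⇒x≢y)
open import Data.Vec.Base using ([]; _∷_)
open import Data.Vec.Functional renaming (_∷_ to _◂_) using ()
open import Data.Product using (∃; ∃₂; _,_)
open import Data.Sum using (_⊎_; inj₁; inj₂)
open import Data.Unit using (⊤; tt)
open import Function using (_∘_)
open import Relation.Nullary using (Dec; yes; no; contradiction)
open import Relation.Nullary.Decidable using (_×-dec_; _⊎-dec_; _→-dec_; ¬?; toWitness; decidable-stable)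
open import Relation.Binary.PropositionalEquality using (_≢_; sym; cong; cong₂; module ≡-Reasoning)

∣p∪q∣≤∣p∣+∣q∣ : ∀ {n} (p q : Subset n) → ∣ p ∪ q ∣ ≤ ∣ p ∣ + ∣ q ∣
∣p∪q∣≤∣p∣+∣q∣ []            []            = z≤n
∣p∪q∣≤∣p∣+∣q∣ (inside  ∷ p) (t       ∷ q) =
  s≤s (≤-trans (∣p∪q∣≤∣p∣+∣q∣ p q) (+-monoʳ-≤ ∣ p ∣ (∣p∣≤∣x∷p∣ t q)))
∣p∪q∣≤∣p∣+∣q∣ (outside ∷ p) (inside  ∷ q) =
  ≤-trans (s≤s (∣p∪q∣≤∣p∣+∣q∣ p q)) (≤-reflexive (sym (+-suc ∣ p ∣ ∣ q ∣)))
∣p∪q∣≤∣p∣+∣q∣ (outside ∷ p) (outside ∷ q) = ∣p∪q∣≤∣p∣+∣q∣ p q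

∣⁅x⁆∪⁅y⁆∣≤2 : ∀ {n} (x y : Fin n) → ∣ ⁅ x ⁆ ∪ ⁅ y ⁆ ∣ ≤ 2
∣⁅x⁆∪⁅y⁆∣≤2 x y = ≤-trans (∣p∪q∣≤∣p∣+∣q∣ ⁅ x ⁆ ⁅ y ⁆) (≤-reflexive (cong₂ _+_ (∣⁅x⁆∣≡1 x) (∣⁅x⁆∣≡1 y)))

∣q∣<∣p∣⇒∃x∈p∉q : ∀ {n} {p q : Subset n} → ∣ q ∣ < ∣ p ∣ → ∃ λ x → x ∈ p × x ∉ q
∣q∣<∣p∣⇒∃x∈p∉q {p = p} {q} ∣q∣<∣p∣ with any? (λ x → (x ∈? p) ×-dec ¬? (x ∈? q))
... | yes witness = witness
... | no  none    = contradiction (p⊆q⇒∣p∣≤∣q∣ p⊆q) (<⇒≱ ∣q∣<∣p∣)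
  where
  p⊆q : ∀ {x} → x ∈ p → x ∈ q
  p⊆q {x} x∈p = decidable-stable (x ∈? q) (λ x∉q → none (x , x∈p , x∉q))

DistinctPair : ∀ {n} → (Fin n → Set) → Set
DistinctPair P = ∃₂ λ x y → x ≢ y × P x × P y

∣p∣≥1⇒nonempty : ∀ {n} {p : Subset n} → 1 ≤ ∣ p ∣ → Nonempty p
∣p∣≥1⇒nonempty {n} 1≤∣p∣ with ∣q∣<∣p∣⇒∃x∈p∉q {q = ⊥} (≤-reflexive (cong suc (∣⊥∣≡0 n)) ⟨<-≤⟩ 1≤∣p∣)
... | x , x∈p , _ = x , x∈p

∣p∣≥2⇒distinctPair : ∀ {n} {p : Subset n} → 2 ≤ ∣ p ∣ → DistinctPair (_∈ p)
∣p∣≥2⇒distinctPair 2≤∣p∣ with ∣p∣≥1⇒nonempty (≤-trans (s≤s z≤n) 2≤∣p∣)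
... | x , x∈p with ∣q∣<∣p∣⇒∃x∈p∉q {q = ⁅ x ⁆} (≤-reflexive (cong suc (∣⁅x⁆∣≡1 x)) ⟨<-≤⟩ 2≤∣p∣)
... | y , y∈p , y∉⁅x⁆ = x , y , x∉⁅y⁆⇒x≢y y∉⁅x⁆ ∘ sym , x∈p , y∈p

[m%d+n]%d≡[m+n]%d : ∀ m n d .{{_ : NonZero d}} → (m % d + n) % d ≡ (m + n) % d
[m%d+n]%d≡[m+n]%d m n d = begin
  (m % d + n) % d           ≡⟨ %-distribˡ-+ (m % d) n d ⟩
  (m % d % d + n % d) % d   ≡⟨ cong (λ r → (r + n % d) % d) (m%n%n≡m%n m d) ⟩
  (m % d + n % d) % d       ≡⟨ %-distribˡ-+ m n d ⟨
  (m + n) % d               ∎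
  where open ≡-Reasoning

compatible? : ∀ c d → Dec (Compatible c d)
compatible? c d = (2 ≤? absDiff (toℕ c) (toℕ d)) ×-dec (absDiff (toℕ c) (toℕ d) ≤? 5)

CompatibleWithOneOf : Colour → Colour → Colour → Set
CompatibleWithOneOf c₁ c₂ d = Compatible c₁ d ⊎ Compatible c₂ d

compatibleWithOneOf? : ∀ c₁ c₂ d → Dec (CompatibleWithOneOf c₁ c₂ d)
compatibleWithOneOf? c₁ c₂ d = compatible? c₁ d ⊎-dec compatible? c₂ d

intervalStart : ℕ → Fin 7
intervalStart a = fromℕ< (m%n<n a 7)

intervalColour : Fin 7 → Fin 4 → Colour
intervalColour r j = fromℕ< (m%n<n (toℕ r + toℕ j) 7)

intervalColour-∈ : ∀ a j → InCyclicInterval a 4 (intervalColour (intervalStart a) j)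
intervalColour-∈ a j = toℕ j , toℕ<n j , (begin
  toℕ (intervalColour (intervalStart a) j)  ≡⟨ toℕ-fromℕ< _ ⟩
  (toℕ (intervalStart a) + toℕ j) % 7       ≡⟨ cong (λ s → (s + toℕ j) % 7) (toℕ-fromℕ< (m%n<n a 7)) ⟩
  (a % 7 + toℕ j) % 7                       ≡⟨ [m%d+n]%d≡[m+n]%d a (toℕ j) 7 ⟩
  (a + toℕ j) % 7                           ∎)
  where open ≡-Reasoning

-- Both facts are decided by evaluation over all colours; 'abstract' keeps the
-- decision procedures from being re-evaluated where the facts are used.
abstract
  at-most-two-incompatible : ∀ {c₁ c₂} → c₁ ≢ c₂ →
    ∃₂ λ b₁ b₂ → ∀ d → d ∉ ⁅ b₁ ⁆ ∪ ⁅ b₂ ⁆ → CompatibleWithOneOf c₁ c₂ d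
  at-most-two-incompatible {c₁} {c₂} = toWitness {a? = all? λ c₁ → all? λ c₂ →
    ¬? (c₁ ≟ c₂) →-dec any? λ (b₁ : Colour) → any? λ (b₂ : Colour) → all? λ d →
    ¬? (d ∈? ⁅ b₁ ⁆ ∪ ⁅ b₂ ⁆) →-dec compatibleWithOneOf? c₁ c₂ d} _ c₁ c₂

  interval-has-two-compatible : ∀ r {c₁ c₂} → c₁ ≢ c₂ → ∃₂ λ i j →
    intervalColour r i ≢ intervalColour r j ×
    CompatibleWithOneOf c₁ c₂ (intervalColour r i) × CompatibleWithOneOf c₁ c₂ (intervalColour r j)
  interval-has-two-compatible r {c₁} {c₂} = toWitness {a? = all? λ r → all? λ c₁ → all? λ c₂ →
    ¬? (c₁ ≟ c₂) →-dec any? λ i → any? λ j →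
    ¬? (intervalColour r i ≟ intervalColour r j) ×-dec
    compatibleWithOneOf? c₁ c₂ (intervalColour r i) ×-dec compatibleWithOneOf? c₁ c₂ (intervalColour r j)} _ r c₁ c₂

compatible-in : ∀ {p c₁ c₂} → c₁ ≢ c₂ → 3 ≤ ∣ p ∣ → ∃ λ d → d ∈ p × CompatibleWithOneOf c₁ c₂ d
compatible-in c₁≢c₂ 3≤∣p∣ with at-most-two-incompatible c₁≢c₂
... | b₁ , b₂ , compatible with ∣q∣<∣p∣⇒∃x∈p∉q (s≤s (∣⁅x⁆∪⁅y⁆∣≤2 b₁ b₂) ⟨<-≤⟩ 3≤∣p∣)
... | d , d∈p , d∉b₁b₂ = d , d∈p , compatible d d∉b₁b₂

consecutive-has-two-compatible : ∀ {p c₁ c₂} → Contains4Consecutive p → c₁ ≢ c₂ →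
  DistinctPair λ d → d ∈ p × CompatibleWithOneOf c₁ c₂ d
consecutive-has-two-compatible (a , interval⊆p) c₁≢c₂
  with interval-has-two-compatible (intervalStart a) c₁≢c₂
... | i , j , distinct , compatibleᵢ , compatibleⱼ =
  _ , _ , distinct ,
  (interval⊆p _ (intervalColour-∈ a i) , compatibleᵢ) ,
  (interval⊆p _ (intervalColour-∈ a j) , compatibleⱼ)

single-vertex-colouring : ∀ {L : Fin 1 → Subset 7} {d} → d ∈ L zero → IsL72Colouring 1 L (λ _ → d)
single-vertex-colouring d∈L₀ = (λ { zero → d∈L₀ }) , λ { _ (s≤s ()) }

prepend : ∀ {k} {L : Fin (suc (suc k)) → Subset 7} {d g} → d ∈ L zero → Compatible d (g zero) →
  IsL72Colouring (suc k) (L ∘ suc) g → IsL72Colouring (suc (suc k)) L (d ◂ g)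
prepend d∈L₀ compatible (g∈L , g-edges) =
  (λ { zero → d∈L₀ ; (suc v) → g∈L v }) , λ { zero _ → compatible ; (suc i) (s≤s i+2≤k) → g-edges i i+2≤k }

prepend-one-of : ∀ {k} {L : Fin (suc (suc k)) → Subset 7} {P : Colour → Set} {d₁ d₂ g} →
  d₁ ∈ L zero × P d₁ → d₂ ∈ L zero × P d₂ →
  IsL72Colouring (suc k) (L ∘ suc) g → CompatibleWithOneOf d₁ d₂ (g zero) →
  ∃ λ f → IsL72Colouring (suc (suc k)) L f × P (f zero)
prepend-one-of (d₁∈L₀ , Pd₁) _ g-colouring (inj₁ compatible) = _ , prepend d₁∈L₀ compatible g-colouring , Pd₁
prepend-one-of _ (d₂∈L₀ , Pd₂) g-colouring (inj₂ compatible) = _ , prepend d₂∈L₀ compatible g-colouring , Pd₂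

colouring-after-one-of : ∀ k (L : Fin (suc k) → Subset 7) →
  (∀ v → v ≢ fromℕ k → Contains4Consecutive (L v)) → 3 ≤ ∣ L (fromℕ k) ∣ →
  ∀ {c₁ c₂} → c₁ ≢ c₂ → ∃ λ f → IsL72Colouring (suc k) L f × CompatibleWithOneOf c₁ c₂ (f zero)
colouring-after-one-of zero L _ 3≤∣Lₖ∣ c₁≢c₂ with compatible-in c₁≢c₂ 3≤∣Lₖ∣
... | d , d∈L₀ , compatible = (λ _ → d) , single-vertex-colouring d∈L₀ , compatible
colouring-after-one-of (suc k) L inner 3≤∣Lₖ∣ c₁≢c₂
  with consecutive-has-two-compatible (inner zero λ ()) c₁≢c₂
... | d₁ , d₂ , d₁≢d₂ , candidate₁ , candidate₂
  with colouring-after-one-of k (L ∘ suc) (λ v v≢k → inner (suc v) (v≢k ∘ suc-injective)) 3≤∣Lₖ∣ d₁≢d₂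
... | g , g-colouring , compatible = prepend-one-of candidate₁ candidate₂ g-colouring compatible

lemma4p2 : (n : ℕ) → (L : Fin (suc n) → Subset 7) →
    (∀ (v : Fin (suc n)) → ¬ (v ≡ zero) → ¬ (v ≡ fromℕ n) → Contains4Consecutive (L v)) →
    IsCyclicInterval (L zero) → IsCyclicInterval (L (fromℕ n)) →
    2 ≤ ∣ L zero ∣ → 3 ≤ ∣ L (fromℕ n) ∣ →
    Σ (Fin (suc n) → Colour) λ f → IsL72Colouring (suc n) L f
lemma4p2 zero L _ _ _ _ 3≤∣Ly∣ with ∣p∣≥1⇒nonempty (≤-trans (s≤s z≤n) 3≤∣Ly∣)
... | d , d∈Ly = (λ _ → d) , single-vertex-colouring d∈Ly
lemma4p2 (suc n) L inner _ _ 2≤∣Lx∣ 3≤∣Ly∣ with ∣p∣≥2⇒distinctPair 2≤∣Lx∣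
... | c₁ , c₂ , c₁≢c₂ , c₁∈Lx , c₂∈Lx
  with colouring-after-one-of n (L ∘ suc) (λ v v≢y → inner (suc v) (λ ()) (v≢y ∘ suc-injective)) 3≤∣Ly∣ c₁≢c₂
... | g , g-colouring , compatible
  with prepend-one-of {P = λ _ → ⊤} (c₁∈Lx , tt) (c₂∈Lx , tt) g-colouring compatible
... | f , f-colouring , _ = f , f-colouring
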